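{- Let $k,m,n$ be positive integers. If $mn>k(m+n+5)$, then $\mu_{\mathrm{int}}(\widehat{K}_{m,n})>k$.
   Context: Graphs are finite and simple. A $k$-improper edge coloring of a graph $H$ is a map $\alpha:E(H)\to\mathbb{N}$ such that at most $k$ edges with a common endpoint receive the same color; it is an improper interval coloring if at every vertex the colors on incident edges form a set of consecutive integers. $\mu_{\mathrm{int}}(H)$ is the smallest $k$ such that $H$ has a $k$-improper interval edge coloring. For a graph $G$, $\widehat{G}$ is the graph obtained by subdividing every edge $v_iv_j$ of $G$ with a new vertex $w_{ij}$ and then adding one further new vertex $u$ adjacent to all the subdivision vertices $w_{ij}$. $K_{m,n}$ is the complete bipartite graph with parts of sizes $m$ and $n$. -}

module Defs where

open import Data.Nat using (ℕ; _≤_; _<_; _+_; _≟_)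
open import Data.Fin using (Fin; inject+; raise; fromℕ; _↑ˡ_; _↑ʳ_)
import Data.Fin as F
open import Data.List using (List; length; lookup; filter; allFin; concatMap; map; _∷_; [])
open import Data.Product using (_×_; _,_; proj₁; proj₂; ∃)
open import Data.Sum using (_⊎_)
open import Relation.Nullary using (¬_)
open import Relation.Nullary.Decidable using (_×-dec_; _⊎-dec_)
open import Relation.Binary.PropositionalEquality using (_≡_)

-- A finite graph: vertex set Fin order, edges given as a list of
-- (unordered) pairs of endpoints.
record Graph : Set where
  field
    order : ℕ
    edges : List (Fin order × Fin order)

open Graph public

EdgeIx : Graph → Set
EdgeIx G = Fin (length (edges G))

end₁ end₂ : (G : Graph) → EdgeIx G → Fin (order G)
end₁ G e = proj₁ (lookup (edges G) e)
end₂ G e = proj₂ (lookup (edges G) e)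

Incident : (G : Graph) → Fin (order G) → EdgeIx G → Set
Incident G v e = (v ≡ end₁ G e) ⊎ (v ≡ end₂ G e)

Simple : Graph → Set
Simple G = (∀ e → ¬ (end₁ G e ≡ end₂ G e))
         × (∀ e f → ((end₁ G e ≡ end₁ G f × end₂ G e ≡ end₂ G f)
                    ⊎ (end₁ G e ≡ end₂ G f × end₂ G e ≡ end₁ G f)) → e ≡ f)

EdgeColoring : Graph → Set
EdgeColoring G = EdgeIx G → ℕ

colorDeg : (G : Graph) → EdgeColoring G → Fin (order G) → ℕ → ℕ
colorDeg G α v c =
  length (filter (λ e → ((v F.≟ end₁ G e) ⊎-dec (v F.≟ end₂ G e)) ×-dec (α e ≟ c))
                 (allFin (length (edges G))))

IsImproper : (G : Graph) → ℕ → EdgeColoring G → Set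
IsImproper G k α = ∀ v c → colorDeg G α v c ≤ k

IsInterval : (G : Graph) → EdgeColoring G → Set
IsInterval G α = ∀ v e f c → Incident G v e → Incident G v f →
  α e ≤ c → c ≤ α f → ∃ λ g → Incident G v g × α g ≡ c

HasImproperIntervalColoring : Graph → ℕ → Set
HasImproperIntervalColoring G k =
  ∃ λ (α : EdgeColoring G) → IsImproper G k α × IsInterval G α

IsMuInt : Graph → ℕ → Set
IsMuInt G μ = HasImproperIntervalColoring G μ
            × (∀ k → k < μ → ¬ HasImproperIntervalColoring G k)

-- complete bipartite graph K_{m,n}: vertices Fin (m + n), parts
-- {i ↑ˡ n} (size m) and {m ↑ʳ j} (size n)
K : ℕ → ℕ → Graph
K m n = record
  { order = m + n
  ; edges = concatMap (λ i → map (λ j → (i ↑ˡ n , m ↑ʳ j)) (allFin n)) (allFin m) }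

-- Ĝ: subdivide each edge e = v_a v_b by w_e, add u adjacent to all w_e.
hat : Graph → Graph
hat G = record
  { order = order G + E + 1
  ; edges = concatMap
      (λ e → (vtx (end₁ G e) , w e) ∷ (w e , vtx (end₂ G e)) ∷ (w e , u) ∷ [])
      (allFin E) }
  where
  E = length (edges G)
  vtx : Fin (order G) → Fin (order G + E + 1)
  vtx a = (a ↑ˡ E) ↑ˡ 1
  w : Fin E → Fin (order G + E + 1)
  w e = (order G ↑ʳ e) ↑ˡ 1
  u : Fin (order G + E + 1)
  u = (order G + E) ↑ʳ F.zero

module Submission where

-- In an interval colouring, the colours of two edges at a vertex of degree D
-- differ by at most D − 1. In the subdivided graph, any two spokes u w_ij and
-- u w_i′j′ are joined by the walk u, w_ij, v_i, w_ij′, v′_j′, w_i′j′, u through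
-- vertices of degrees 3, n, 3, m, 3, so the mn spoke colours at u lie in a
-- window of m + n + 5 colours. A k-improper colouring uses each colour on at
-- most k spokes, hence mn ≤ k(m + n + 5).

open import Data.Nat using (ℕ; zero; suc; _≤_; _<_; _+_; _*_; _≟_; _≤?_; z≤n; s≤s)
open import Data.Nat.Properties
open import Data.Nat.Tactic.RingSolver using (solve-∀)
open import Data.Fin using (Fin; toℕ; _↑ˡ_; _↑ʳ_; splitAt)
import Data.Fin as F
import Data.Fin.Properties as FP
open import Data.List using (List; []; _∷_; _++_; length; lookup; filter; allFin; tabulate; map; concatMap)
open import Data.List.Properties using (length-++; length-map; length-tabulate; filter-accept)
open import Data.List.Extrema.Nat using (argmin; f[argmin]≤f[xs])
open import Data.List.Membership.Propositional using (_∈_)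
open import Data.List.Membership.Propositional.Properties using (∈-filter⁺; ∈-allFin)
open import Data.List.Relation.Unary.All as All using ()
open import Data.List.Relation.Unary.Any using (index)
open import Data.List.Relation.Unary.Any.Properties using (lookup-index)
open import Data.List.Relation.Binary.Sublist.Propositional using (⊆-refl)
open import Data.List.Relation.Binary.Sublist.Propositional.Properties using (filter⁺; length-mono-≤)
open import Data.Product using (_×_; _,_; proj₁; proj₂; ∃; ∃₂)
open import Data.Sum using (_⊎_; inj₁; inj₂)
open import Data.Empty using (⊥-elim)
open import Function using (_∘_; id)
open import Function.Definitions using (Injective)
open import Relation.Nullary using (yes; no; contradiction)
open import Relation.Nullary.Decidable using (_×-dec_; _⊎-dec_)
open import Relation.Unary using (Decidable)
open import Relation.Binary.PropositionalEquality
open import Defs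

module _ {A : Set} where

  index++ˡ : (xs ys : List A) → Fin (length xs) → Fin (length (xs ++ ys))
  index++ˡ (x ∷ xs) ys F.zero    = F.zero
  index++ˡ (x ∷ xs) ys (F.suc i) = F.suc (index++ˡ xs ys i)

  index++ʳ : (xs ys : List A) → Fin (length ys) → Fin (length (xs ++ ys))
  index++ʳ []       ys j = j
  index++ʳ (x ∷ xs) ys j = F.suc (index++ʳ xs ys j)

  lookup-index++ˡ : ∀ xs ys i → lookup (xs ++ ys) (index++ˡ xs ys i) ≡ lookup xs i
  lookup-index++ˡ (x ∷ xs) ys F.zero    = refl
  lookup-index++ˡ (x ∷ xs) ys (F.suc i) = lookup-index++ˡ xs ys i

  lookup-index++ʳ : ∀ xs ys j → lookup (xs ++ ys) (index++ʳ xs ys j) ≡ lookup ys j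
  lookup-index++ʳ []       ys j = refl
  lookup-index++ʳ (x ∷ xs) ys j = lookup-index++ʳ xs ys j

  index++-cases : ∀ xs ys (g : Fin (length (xs ++ ys))) →
    (∃ λ i → g ≡ index++ˡ xs ys i) ⊎ (∃ λ j → g ≡ index++ʳ xs ys j)
  index++-cases []       ys g         = inj₂ (g , refl)
  index++-cases (x ∷ xs) ys F.zero    = inj₁ (F.zero , refl)
  index++-cases (x ∷ xs) ys (F.suc g) with index++-cases xs ys g
  ... | inj₁ (i , g≡i) = inj₁ (F.suc i , cong F.suc g≡i)
  ... | inj₂ (j , g≡j) = inj₂ (j , cong F.suc g≡j)

module _ {A B : Set} (f : A → List B) where

  indexConcatMap : ∀ {N} (g : Fin N → A) (p : Fin N) → Fin (length (f (g p))) →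
    Fin (length (concatMap f (tabulate g)))
  indexConcatMap g F.zero    q = index++ˡ (f (g F.zero)) _ q
  indexConcatMap g (F.suc p) q = index++ʳ (f (g F.zero)) _ (indexConcatMap (g ∘ F.suc) p q)

  lookup-indexConcatMap : ∀ {N} (g : Fin N → A) p q →
    lookup (concatMap f (tabulate g)) (indexConcatMap g p q) ≡ lookup (f (g p)) q
  lookup-indexConcatMap g F.zero    q = lookup-index++ˡ (f (g F.zero)) _ q
  lookup-indexConcatMap g (F.suc p) q =
    trans (lookup-index++ʳ (f (g F.zero)) _ _) (lookup-indexConcatMap (g ∘ F.suc) p q)

  indexConcatMap-surjective : ∀ {N} (g : Fin N → A) x → ∃₂ λ p q → x ≡ indexConcatMap g p q
  indexConcatMap-surjective {suc N} g x
    with index++-cases (f (g F.zero)) (concatMap f (tabulate (g ∘ F.suc))) x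
  ... | inj₁ (q , x≡q) = F.zero , q , x≡q
  ... | inj₂ (y , x≡y) with indexConcatMap-surjective (g ∘ F.suc) y
  ...   | p , q , y≡pq = F.suc p , q , trans x≡y (cong (index++ʳ (f (g F.zero)) _) y≡pq)

  length-concatMap-const : ∀ {N} (g : Fin N → A) c → (∀ p → length (f (g p)) ≡ c) →
    length (concatMap f (tabulate g)) ≡ N * c
  length-concatMap-const {zero}  g c _     = refl
  length-concatMap-const {suc N} g c const = trans (length-++ (f (g F.zero)))
    (cong₂ _+_ (const F.zero) (length-concatMap-const (g ∘ F.suc) c (const ∘ F.suc)))

module _ {A B : Set} (h : A → B) where

  indexMap : ∀ {N} (g : Fin N → A) → Fin N → Fin (length (map h (tabulate g)))
  indexMap g F.zero    = F.zero
  indexMap g (F.suc p) = F.suc (indexMap (g ∘ F.suc) p)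

  lookup-indexMap : ∀ {N} (g : Fin N → A) p → lookup (map h (tabulate g)) (indexMap g p) ≡ h (g p)
  lookup-indexMap g F.zero    = refl
  lookup-indexMap g (F.suc p) = lookup-indexMap (g ∘ F.suc) p

  indexMap-surjective : ∀ {N} (g : Fin N → A) x → ∃ λ p → x ≡ indexMap g p
  indexMap-surjective {suc N} g F.zero    = F.zero , refl
  indexMap-surjective {suc N} g (F.suc x) with indexMap-surjective (g ∘ F.suc) x
  ... | p , x≡p = F.suc p , cong F.suc x≡p

filter-grows : ∀ {A : Set} {S : A → Set} (S? : Decidable S) x xs →
  length (filter S? xs) ≤ length (filter S? (x ∷ xs))
filter-grows S? x xs with S? x
... | yes _ = n≤1+n _
... | no _  = ≤-refl

module _ {A : Set} {P Q : A → Set} (P? : Decidable P) (Q? : Decidable Q) where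

  length-filter-mono : (∀ {x} → P x → Q x) → ∀ xs → length (filter P? xs) ≤ length (filter Q? xs)
  length-filter-mono P⊆Q xs =
    length-mono-≤ (filter⁺ P? Q? (λ a≡b → subst Q a≡b ∘ P⊆Q) (⊆-refl {x = xs}))

  length-filter-∪ : ∀ {R : A → Set} (R? : Decidable R) → (∀ {x} → R x → P x ⊎ Q x) → ∀ xs →
    length (filter R? xs) ≤ length (filter P? xs) + length (filter Q? xs)
  length-filter-∪ R? R⊆P∪Q []       = z≤n
  length-filter-∪ R? R⊆P∪Q (x ∷ xs) with ih ← length-filter-∪ R? R⊆P∪Q xs | R? x
  ... | no _ = ≤-trans ih (+-mono-≤ (filter-grows P? x xs) (filter-grows Q? x xs))
  ... | yes r with R⊆P∪Q r
  ...   | inj₁ p = subst (λ l → _ ≤ l + _) (sym (cong length (filter-accept P? p)))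
    (s≤s (≤-trans ih (+-monoʳ-≤ _ (filter-grows Q? x xs))))
  ...   | inj₂ q = subst (λ l → _ ≤ _ + l) (sym (cong length (filter-accept Q? q)))
    (≤-trans (s≤s (≤-trans ih (+-monoˡ-≤ _ (filter-grows P? x xs)))) (≤-reflexive (sym (+-suc _ _))))

injective⇒≤-length-filter : ∀ {M N} {P : Fin N → Set} (P? : Decidable P) (ι : Fin M → Fin N) →
  Injective _≡_ _≡_ ι → (∀ i → P (ι i)) → M ≤ length (filter P? (allFin N))
injective⇒≤-length-filter {N = N} P? ι ι-injective Pι = FP.injective⇒≤ position-injective
  where
  member : ∀ i → ι i ∈ filter P? (allFin N)
  member i = ∈-filter⁺ P? (∈-allFin (ι i)) (Pι i)
  position-injective : Injective _≡_ _≡_ (index ∘ member)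
  position-injective {a} {b} eq = ι-injective (begin
    ι a                                           ≡⟨ lookup-index (member a) ⟩
    lookup (filter P? (allFin N)) (index (member a)) ≡⟨ cong (lookup (filter P? (allFin N))) eq ⟩
    lookup (filter P? (allFin N)) (index (member b)) ≡⟨ lookup-index (member b) ⟨
    ι b                                           ∎)
    where open ≡-Reasoning

module _ (G : Graph) (α : EdgeColoring G) (v : Fin (order G)) where

  edgeList : List (EdgeIx G)
  edgeList = allFin (length (edges G))

  incident? : Decidable (Incident G v)
  incident? e = (v F.≟ end₁ G e) ⊎-dec (v F.≟ end₂ G e)

  InWindow : ℕ → ℕ → EdgeIx G → Set
  InWindow c d e = Incident G v e × c ≤ α e × α e ≤ c + d

  inWindow? : ∀ c d → Decidable (InWindow c d)
  inWindow? c d e = incident? e ×-dec ((c ≤? α e) ×-dec (α e ≤? c + d))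

  windowSize≤ : ∀ {k} → IsImproper G k α → ∀ c d →
    length (filter (inWindow? c d) edgeList) ≤ suc d * k
  windowSize≤ {k} improper c zero = begin
    length (filter (inWindow? c zero) edgeList)
      ≤⟨ length-filter-mono (inWindow? c zero) (λ e → incident? e ×-dec (α e ≟ c)) inColour edgeList ⟩
    colorDeg G α v c ≤⟨ improper v c ⟩
    k                ≡⟨ +-identityʳ k ⟨
    1 * k            ∎
    where
    open ≤-Reasoning
    inColour : ∀ {e} → InWindow c zero e → Incident G v e × α e ≡ c
    inColour {e} (ve , c≤ , ≤c+0) = ve , ≤-antisym (subst (α e ≤_) (+-identityʳ c) ≤c+0) c≤
  windowSize≤ {k} improper c (suc d) = begin
    length (filter (inWindow? c (suc d)) edgeList)
      ≤⟨ length-filter-∪ (inWindow? c d) (λ e → incident? e ×-dec (α e ≟ c + suc d))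
           (inWindow? c (suc d)) narrowOrTop edgeList ⟩
    length (filter (inWindow? c d) edgeList) + colorDeg G α v (c + suc d)
      ≤⟨ +-mono-≤ (windowSize≤ improper c d) (improper v (c + suc d)) ⟩
    suc d * k + k ≡⟨ +-comm (suc d * k) k ⟩
    suc (suc d) * k ∎
    where
    open ≤-Reasoning
    narrowOrTop : ∀ {e} → InWindow c (suc d) e → InWindow c d e ⊎ (Incident G v e × α e ≡ c + suc d)
    narrowOrTop {e} (ve , c≤ , ≤top) with α e ≤? c + d
    ... | yes ≤c+d = inj₁ (ve , c≤ , ≤c+d)
    ... | no  ≰c+d = inj₂ (ve , ≤-antisym ≤top (subst (_≤ α e) (sym (+-suc c d)) (≰⇒> ≰c+d)))

  injective-window⇒≤ : ∀ {k M} → IsImproper G k α → ∀ c d (ι : Fin M → EdgeIx G) →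
    Injective _≡_ _≡_ ι → (∀ i → InWindow c d (ι i)) → M ≤ suc d * k
  injective-window⇒≤ improper c d ι ι-injective inWindow =
    ≤-trans (injective⇒≤-length-filter (inWindow? c d) ι ι-injective inWindow)
            (windowSize≤ improper c d)

  -- Every colour between α x and α y occurs at v, and distinct colours need
  -- distinct edges among the D + 1 edges at v.
  colour-spread : IsInterval G α → ∀ {D} (φ : Fin (suc D) → EdgeIx G) →
    (∀ e → Incident G v e → ∃ λ j → e ≡ φ j) →
    ∀ {x y} → Incident G v x → Incident G v y → α y ≤ α x + D
  colour-spread interval {D} φ covers {x} {y} vx vy with α y ≤? α x + D
  ... | yes y≤ = y≤
  ... | no  y≰ = contradiction (FP.injective⇒≤ slot-injective) (<-irrefl refl)
    where
    top : α x + suc D ≤ α y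
    top = subst (_≤ α y) (sym (+-suc (α x) D)) (≰⇒> y≰)
    realised : (t : Fin (suc (suc D))) → ∃ λ e → Incident G v e × α e ≡ α x + toℕ t
    realised t = interval v x y _ vx vy (m≤m+n (α x) (toℕ t))
      (≤-trans (+-monoʳ-≤ (α x) (FP.toℕ≤pred[n] t)) top)
    slot : Fin (suc (suc D)) → Fin (suc D)
    slot t = proj₁ (covers (proj₁ (realised t)) (proj₁ (proj₂ (realised t))))
    colour-slot : ∀ t → α (φ (slot t)) ≡ α x + toℕ t
    colour-slot t = trans (cong α (sym (proj₂ (covers _ (proj₁ (proj₂ (realised t)))))))
                          (proj₂ (proj₂ (realised t)))
    slot-injective : Injective _≡_ _≡_ slot
    slot-injective {s} {t} eq = FP.toℕ-injective (+-cancelˡ-≡ (α x) _ _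
      (trans (sym (colour-slot s)) (trans (cong (α ∘ φ) eq) (colour-slot t))))

↑ˡ≢↑ʳ : ∀ {m n} (i : Fin m) (j : Fin n) → i ↑ˡ n ≢ m ↑ʳ j
↑ˡ≢↑ʳ {m} {n} i j eq with
  trans (sym (FP.splitAt-↑ˡ m i n)) (trans (cong (splitAt m) eq) (FP.splitAt-↑ʳ m n j))
... | ()

incident-lookup⁻ : (G : Graph) {v : Fin (order G)} {e : EdgeIx G} {p : Fin (order G) × Fin (order G)} →
  lookup (edges G) e ≡ p → Incident G v e → v ≡ proj₁ p ⊎ v ≡ proj₂ p
incident-lookup⁻ G {v} e≡p = subst (λ p → v ≡ proj₁ p ⊎ v ≡ proj₂ p) e≡p

incident-lookup⁺ : (G : Graph) {v : Fin (order G)} {e : EdgeIx G} {p : Fin (order G) × Fin (order G)} →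
  lookup (edges G) e ≡ p → v ≡ proj₁ p ⊎ v ≡ proj₂ p → Incident G v e
incident-lookup⁺ G {v} e≡p = subst (λ p → v ≡ proj₁ p ⊎ v ≡ proj₂ p) (sym e≡p)

pattern toEnd₁ = F.zero
pattern toEnd₂ = F.suc F.zero
pattern toApex = F.suc (F.suc F.zero)

module Hat (G : Graph) where

  E : ℕ
  E = length (edges G)

  Vertex : Set
  Vertex = Fin (order (hat G))

  original : Fin (order G) → Vertex
  original a = (a ↑ˡ E) ↑ˡ 1

  subdivision : EdgeIx G → Vertex
  subdivision e = (order G ↑ʳ e) ↑ˡ 1

  apex : Vertex
  apex = (order G + E) ↑ʳ F.zero

  -- Copied from Defs.hat, so that edges (hat G) is concatMap gadget (allFin E) by definition.
  gadget : EdgeIx G → List (Vertex × Vertex)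
  gadget e = (original (end₁ G e) , subdivision e)
           ∷ (subdivision e , original (end₂ G e))
           ∷ (subdivision e , apex) ∷ []

  hatEdge : EdgeIx G → Fin 3 → EdgeIx (hat G)
  hatEdge = indexConcatMap gadget id

  lookup-hatEdge : ∀ e q → lookup (edges (hat G)) (hatEdge e q) ≡ lookup (gadget e) q
  lookup-hatEdge = lookup-indexConcatMap gadget id

  hatEdge-surjective : ∀ g → ∃₂ λ e q → g ≡ hatEdge e q
  hatEdge-surjective = indexConcatMap-surjective gadget id

  original-injective : Injective _≡_ _≡_ original
  original-injective eq = FP.↑ˡ-injective E _ _ (FP.↑ˡ-injective 1 _ _ eq)

  subdivision-injective : Injective _≡_ _≡_ subdivision
  subdivision-injective eq = FP.↑ʳ-injective (order G) _ _ (FP.↑ˡ-injective 1 _ _ eq)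

  original≢subdivision : ∀ {a e} → original a ≢ subdivision e
  original≢subdivision eq = ↑ˡ≢↑ʳ _ _ (FP.↑ˡ-injective 1 _ _ eq)

  original≢apex : ∀ {a} → original a ≢ apex
  original≢apex = ↑ˡ≢↑ʳ _ _

  subdivision≢apex : ∀ {e} → subdivision e ≢ apex
  subdivision≢apex = ↑ˡ≢↑ʳ _ _

  incident-hatEdge⁻ : ∀ {v} e q → Incident (hat G) v (hatEdge e q) →
    v ≡ proj₁ (lookup (gadget e) q) ⊎ v ≡ proj₂ (lookup (gadget e) q)
  incident-hatEdge⁻ e q = incident-lookup⁻ (hat G) (lookup-hatEdge e q)

  incident-hatEdge⁺ : ∀ {v} e q →
    v ≡ proj₁ (lookup (gadget e) q) ⊎ v ≡ proj₂ (lookup (gadget e) q) →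
    Incident (hat G) v (hatEdge e q)
  incident-hatEdge⁺ e q = incident-lookup⁺ (hat G) (lookup-hatEdge e q)

  subdivision-incident : ∀ e q → Incident (hat G) (subdivision e) (hatEdge e q)
  subdivision-incident e toEnd₁ = incident-hatEdge⁺ e toEnd₁ (inj₂ refl)
  subdivision-incident e toEnd₂ = incident-hatEdge⁺ e toEnd₂ (inj₁ refl)
  subdivision-incident e toApex = incident-hatEdge⁺ e toApex (inj₁ refl)

  subdivision-covers : ∀ e g → Incident (hat G) (subdivision e) g → ∃ λ q → g ≡ hatEdge e q
  subdivision-covers e g ve with hatEdge-surjective g
  ... | e′ , q , refl with q | incident-hatEdge⁻ e′ q ve
  ... | toEnd₁ | inj₁ eq = ⊥-elim (original≢subdivision (sym eq))
  ... | toEnd₁ | inj₂ eq = toEnd₁ , cong (λ e″ → hatEdge e″ toEnd₁) (sym (subdivision-injective eq))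
  ... | toEnd₂ | inj₁ eq = toEnd₂ , cong (λ e″ → hatEdge e″ toEnd₂) (sym (subdivision-injective eq))
  ... | toEnd₂ | inj₂ eq = ⊥-elim (original≢subdivision (sym eq))
  ... | toApex | inj₁ eq = toApex , cong (λ e″ → hatEdge e″ toApex) (sym (subdivision-injective eq))
  ... | toApex | inj₂ eq = ⊥-elim (subdivision≢apex eq)

  original-covers : ∀ a g → Incident (hat G) (original a) g →
    ∃ λ e → (g ≡ hatEdge e toEnd₁ × end₁ G e ≡ a) ⊎ (g ≡ hatEdge e toEnd₂ × end₂ G e ≡ a)
  original-covers a g va with hatEdge-surjective g
  ... | e , q , refl with q | incident-hatEdge⁻ e q va
  ... | toEnd₁ | inj₁ eq = e , inj₁ (refl , sym (original-injective eq))
  ... | toEnd₁ | inj₂ eq = ⊥-elim (original≢subdivision eq)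
  ... | toEnd₂ | inj₁ eq = ⊥-elim (original≢subdivision eq)
  ... | toEnd₂ | inj₂ eq = e , inj₂ (refl , sym (original-injective eq))
  ... | toApex | inj₁ eq = ⊥-elim (original≢subdivision eq)
  ... | toApex | inj₂ eq = ⊥-elim (original≢apex eq)

  spoke : EdgeIx G → EdgeIx (hat G)
  spoke e = hatEdge e toApex

  spoke-incident : ∀ e → Incident (hat G) apex (spoke e)
  spoke-incident e = incident-hatEdge⁺ e toApex (inj₂ refl)

  spoke-injective : Injective _≡_ _≡_ spoke
  spoke-injective {a} {b} eq = subdivision-injective (begin
    subdivision a                       ≡⟨ cong proj₁ (lookup-hatEdge a toApex) ⟨
    proj₁ (lookup (edges (hat G)) (spoke a)) ≡⟨ cong (proj₁ ∘ lookup (edges (hat G))) eq ⟩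
    proj₁ (lookup (edges (hat G)) (spoke b)) ≡⟨ cong proj₁ (lookup-hatEdge b toApex) ⟩
    subdivision b                       ∎)
    where open ≡-Reasoning

module Complete (m n : ℕ) where

  pair : Fin m → Fin n → Fin (m + n) × Fin (m + n)
  pair i j = (i ↑ˡ n , m ↑ʳ j)

  row : Fin m → List (Fin (m + n) × Fin (m + n))
  row i = map (pair i) (allFin n)

  kEdge : Fin m → Fin n → EdgeIx (K m n)
  kEdge i j = indexConcatMap row id i (indexMap (pair i) id j)

  lookup-kEdge : ∀ i j → lookup (edges (K m n)) (kEdge i j) ≡ pair i j
  lookup-kEdge i j = trans (lookup-indexConcatMap row id i _) (lookup-indexMap (pair i) id j)

  end₁-kEdge : ∀ i j → end₁ (K m n) (kEdge i j) ≡ i ↑ˡ n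
  end₁-kEdge i j = cong proj₁ (lookup-kEdge i j)

  end₂-kEdge : ∀ i j → end₂ (K m n) (kEdge i j) ≡ m ↑ʳ j
  end₂-kEdge i j = cong proj₂ (lookup-kEdge i j)

  kEdge-surjective : ∀ e → ∃₂ λ i j → e ≡ kEdge i j
  kEdge-surjective e with indexConcatMap-surjective row id e
  ... | i , q , e≡iq with indexMap-surjective (pair i) id q
  ...   | j , q≡j = i , j , trans e≡iq (cong (indexConcatMap row id i) q≡j)

  length-edges-K : length (edges (K m n)) ≡ m * n
  length-edges-K = length-concatMap-const row id n
    (λ i → trans (length-map (pair i) (allFin n)) (length-tabulate id))

  open Hat (K m n)

  left-covers : ∀ i g → Incident (hat (K m n)) (original (i ↑ˡ n)) g →
    ∃ λ j → g ≡ hatEdge (kEdge i j) toEnd₁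
  left-covers i g vg with original-covers (i ↑ˡ n) g vg
  ... | e , side with kEdge-surjective e
  ...   | i′ , j , refl with side
  ... | inj₁ (refl , i′≡i) =
    j , cong (λ i″ → hatEdge (kEdge i″ j) toEnd₁)
             (FP.↑ˡ-injective n _ _ (trans (sym (end₁-kEdge i′ j)) i′≡i))
  ... | inj₂ (_ , j≡i) = ⊥-elim (↑ˡ≢↑ʳ i j (trans (sym j≡i) (end₂-kEdge i′ j)))

  right-covers : ∀ j g → Incident (hat (K m n)) (original (m ↑ʳ j)) g →
    ∃ λ i → g ≡ hatEdge (kEdge i j) toEnd₂
  right-covers j g vg with original-covers (m ↑ʳ j) g vg
  ... | e , side with kEdge-surjective e
  ...   | i , j′ , refl with side
  ... | inj₁ (_ , i≡j) = ⊥-elim (↑ˡ≢↑ʳ i j (trans (sym (end₁-kEdge i j′)) i≡j))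
  ... | inj₂ (refl , j′≡j) =
    i , cong (λ j″ → hatEdge (kEdge i j″) toEnd₂)
             (FP.↑ʳ-injective m _ _ (trans (sym (end₂-kEdge i j′)) j′≡j))

K̂ : ℕ → ℕ → Graph
K̂ m n = hat (K m n)

≤-extend : ∀ c {g x y a} → x ≤ c + g → y ≤ x + a → y ≤ c + (g + a)
≤-extend c {g} {a = a} x≤c+g y≤x+a =
  ≤-trans y≤x+a (≤-trans (+-monoˡ-≤ a x≤c+g) (≤-reflexive (+-assoc c g a)))

module SpokeColours (m′ n′ : ℕ) (α : EdgeColoring (K̂ (suc m′) (suc n′)))
                    (interval : IsInterval (K̂ (suc m′) (suc n′)) α) where

  open Complete (suc m′) (suc n′)
  open Hat (K (suc m′) (suc n′))

  at-subdivision : ∀ e q q′ → α (hatEdge e q′) ≤ α (hatEdge e q) + 2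
  at-subdivision e q q′ = colour-spread (K̂ (suc m′) (suc n′)) α (subdivision e) interval
    (hatEdge e) (subdivision-covers e) (subdivision-incident e q) (subdivision-incident e q′)

  at-left : ∀ i j j′ → α (hatEdge (kEdge i j′) toEnd₁) ≤ α (hatEdge (kEdge i j) toEnd₁) + n′
  at-left i j j′ = colour-spread (K̂ (suc m′) (suc n′)) α (original (i ↑ˡ suc n′)) interval
    _ (left-covers i) (left-incident j) (left-incident j′)
    where
    left-incident : ∀ j →
      Incident (K̂ (suc m′) (suc n′)) (original (i ↑ˡ suc n′)) (hatEdge (kEdge i j) toEnd₁)
    left-incident j = incident-hatEdge⁺ (kEdge i j) toEnd₁ (inj₁ (cong original (sym (end₁-kEdge i j))))

  at-right : ∀ j i i′ → α (hatEdge (kEdge i′ j) toEnd₂) ≤ α (hatEdge (kEdge i j) toEnd₂) + m′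
  at-right j i i′ = colour-spread (K̂ (suc m′) (suc n′)) α (original (suc m′ ↑ʳ j)) interval
    _ (right-covers j) (right-incident i) (right-incident i′)
    where
    right-incident : ∀ i →
      Incident (K̂ (suc m′) (suc n′)) (original (suc m′ ↑ʳ j)) (hatEdge (kEdge i j) toEnd₂)
    right-incident i = incident-hatEdge⁺ (kEdge i j) toEnd₂ (inj₂ (cong original (sym (end₂-kEdge i j))))

  spoke-spread : ∀ e e′ → α (spoke e′) ≤ α (spoke e) + (2 + n′ + 2 + m′ + 2)
  spoke-spread e e′ with kEdge-surjective e | kEdge-surjective e′
  ... | i , j , refl | i′ , j′ , refl =
    ≤-extend c (≤-extend c (≤-extend c (≤-extend c
      (at-subdivision (kEdge i j) toApex toEnd₁)
      (at-left i j j′))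
      (at-subdivision (kEdge i j′) toEnd₁ toEnd₂))
      (at-right j′ i i′))
      (at-subdivision (kEdge i′ j′) toEnd₂ toApex)
    where c = α (spoke (kEdge i j))

spoke-window-width : ∀ m′ n′ → suc (2 + n′ + 2 + m′ + 2) ≡ suc m′ + suc n′ + 5
spoke-window-width = solve-∀

m*n≤[m+n+5]*k : ∀ m′ n′ {k} (α : EdgeColoring (K̂ (suc m′) (suc n′))) →
  IsImproper (K̂ (suc m′) (suc n′)) k α → IsInterval (K̂ (suc m′) (suc n′)) α →
  suc m′ * suc n′ ≤ (suc m′ + suc n′ + 5) * k
m*n≤[m+n+5]*k m′ n′ {k} α improper interval = begin
  suc m′ * suc n′  ≡⟨ length-edges-K ⟨
  E                ≤⟨ injective-window⇒≤ (K̂ (suc m′) (suc n′)) α apex improper c d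
                        spoke spoke-injective inWindow ⟩
  suc d * k        ≡⟨ cong (_* k) (spoke-window-width m′ n′) ⟩
  (suc m′ + suc n′ + 5) * k ∎
  where
  open ≤-Reasoning
  open Complete (suc m′) (suc n′)
  open Hat (K (suc m′) (suc n′))
  open SpokeColours m′ n′ α interval
  lowest : EdgeIx (K (suc m′) (suc n′))
  lowest = argmin (α ∘ spoke) (kEdge F.zero F.zero) (allFin E)
  c d : ℕ
  c = α (spoke lowest)
  d = 2 + n′ + 2 + m′ + 2
  inWindow : ∀ e → InWindow (K̂ (suc m′) (suc n′)) α apex c d (spoke e)
  inWindow e = spoke-incident e
             , All.lookup (f[argmin]≤f[xs] {f = α ∘ spoke} (kEdge F.zero F.zero) (allFin E)) (∈-allFin e)
             , spoke-spread lowest e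

corollary12 : (k m n : ℕ) → 0 < k → 0 < m → 0 < n →
    k * (m + n + 5) < m * n →
    ∀ μ → IsMuInt (hat (K m n)) μ → k < μ
corollary12 k (suc m′) (suc n′) _ _ _ k[m+n+5]<mn μ ((α , improper , interval) , _) =
  ≰⇒> λ μ≤k → <⇒≱ k[m+n+5]<mn (begin
    suc m′ * suc n′           ≤⟨ m*n≤[m+n+5]*k m′ n′ α (λ v c → ≤-trans (improper v c) μ≤k) interval ⟩
    (suc m′ + suc n′ + 5) * k ≡⟨ *-comm _ k ⟩
    k * (suc m′ + suc n′ + 5) ∎)
  where open ≤-Reasoning
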